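{- There is no term $\mathtt{Por}\in\Lambda_{\mathrm{cbv}}$ such that for all $M,N\in\Lambda_{\mathrm{cbv}}$: $\mathtt{Por}\,(M,N)=_{\mathcal{T}}\mathtt{True}$ if $M\neq_{\mathcal{T}}\Omega$ or $N\neq_{\mathcal{T}}\Omega$, and $\mathtt{Por}\,(M,N)=_{\mathcal{T}}\Omega$ if $M=_{\mathcal{T}}N=_{\mathcal{T}}\Omega$.
   Context: CbV $\lambda$-terms $\Lambda_{\mathrm{cbv}}$ are ordinary $\lambda$-terms modulo $\alpha$-equivalence; values are variables and abstractions. Pairs are encoded as $(M,N):=\lambda z.zMN$; $\mathtt{True}:=\lambda x.\lambda y.x$; $\Omega:=(\lambda x.xx)(\lambda x.xx)$. Resource CbV terms: resource values $v::=x\mid\lambda x.s$, resource simple terms $s::=s_1s_2\mid[v_1,\dots,v_n]$ ($[\cdots]$ a finite multiset), modulo $\alpha$. The resource reduction $\to_{\mathrm{r}}$ (on finite sets of resource terms) is that of Kerinec–Manzonetto–Pagani (Defs. 3.3–3.4 of "Revisiting call-by-value Böhm trees in light of their Taylor expansion"): the contextual closure of $[\lambda x.t]\,[v_1,\dots,v_n]\to t\langle[v_1,\dots,v_n]/x\rangle$ (the set of all ways of replacing the free occurrences of $x$ in $t$ bijectively by $v_1,\dots,v_n$ if there are exactly $n$ of them, $\emptyset$ otherwise) and of $[v_1,\dots,v_n]\,s\to\emptyset$ for $n\ne1$. It is confluent and strongly normalising; $\mathrm{nf}(t)$ is the set of normal terms forming the normal form of $t$. Taylor expansion: $\mathcal{T}(x)=\{[x,\dots,x]\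 (m\text{ copies})\mid m\in\mathbb{N}\}$, $\mathcal{T}(\lambda x.M)=\{[\lambda x.s_1,\dots,\lambda x.s_m]\mid m\in\mathbb{N}, s_j\in\mathcal{T}(M)\}$, $\mathcal{T}(M_1M_2)=\{s_1s_2\mid s_i\in\mathcal{T}(M_i)\}$; $\mathrm{NF}(\mathcal{T}(M))=\bigcup_{s\in\mathcal{T}(M)}\mathrm{nf}(s)$. $M=_{\mathcal{T}}N$ means $\mathrm{NF}(\mathcal{T}(M))=\mathrm{NF}(\mathcal{T}(N))$, and $\neq_{\mathcal{T}}$ is its negation. -}

module Defs where

open import Data.Nat using (ℕ; zero; suc; _+_; _∸_; _<_; _≤_; _<ᵇ_)
open import Data.Bool using (if_then_else_)
open import Data.List using (List; []; _∷_; _++_; replicate; length)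
open import Data.List.Relation.Binary.Permutation.Propositional using (_↭_)
open import Data.Product using (Σ; ∃; _×_; _,_)
open import Relation.Nullary using (¬_)
open import Relation.Binary.PropositionalEquality using (_≡_; _≢_)

-- CbV λ-terms (de Bruijn indices: α-equivalence is syntactic equality)

data Λ : Set where
  var : ℕ → Λ
  lam : Λ → Λ
  app : Λ → Λ → Λ

liftΛ : ℕ → Λ → Λ
liftΛ c (var i)   = if i <ᵇ c then var i else var (suc i)
liftΛ c (lam M)   = lam (liftΛ (suc c) M)
liftΛ c (app M N) = app (liftΛ c M) (liftΛ c N)

-- (M , N) := λz. z M N   (z fresh)
pair : Λ → Λ → Λ
pair M N = lam (app (app (var 0) (liftΛ 0 M)) (liftΛ 0 N))

True : Λ
True = lam (lam (var 1))

δ : Λ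
δ = lam (app (var 0) (var 0))

Ω : Λ
Ω = app δ δ

-- Resource CbV terms; bags are lists, considered up to permutation (≈T)

data RVal : Set
data RTm : Set

data RVal where
  rvar : ℕ → RVal
  rlam : RTm → RVal

data RTm where
  rapp : RTm → RTm → RTm
  bag  : List RVal → RTm

shiftV : ℕ → ℕ → RVal → RVal
shiftT : ℕ → ℕ → RTm → RTm
shiftB : ℕ → ℕ → List RVal → List RVal
shiftV c d (rvar i) = if i <ᵇ c then rvar i else rvar (i + d)
shiftV c d (rlam s) = rlam (shiftT (suc c) d s)
shiftT c d (rapp s t) = rapp (shiftT c d s) (shiftT c d t)
shiftT c d (bag ws)   = bag (shiftB c d ws)
shiftB c d []       = []
shiftB c d (w ∷ ws) = shiftV c d w ∷ shiftB c d ws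

data _≈V_ : RVal → RVal → Set
data _≈T_ : RTm → RTm → Set
data _≈PW_ : List RVal → List RVal → Set

data _≈V_ where
  ≈var : ∀ n → rvar n ≈V rvar n
  ≈lam : ∀ {s s'} → s ≈T s' → rlam s ≈V rlam s'

data _≈T_ where
  ≈app : ∀ {s t s' t'} → s ≈T s' → t ≈T t' → rapp s t ≈T rapp s' t'
  ≈bag : ∀ {ws ws'' ws'} → ws ↭ ws'' → ws'' ≈PW ws' → bag ws ≈T bag ws'

data _≈PW_ where
  []  : [] ≈PW []
  _∷_ : ∀ {v w vs ws} → v ≈V w → vs ≈PW ws → (v ∷ vs) ≈PW (w ∷ ws)

-- LSubT k t vs t' : t lives in context Γ,x,Δ with |Δ| = k (x = index k),
-- vs live in Γ; t' (in Γ,Δ) is one of the terms obtained by replacing the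
-- occurrences of x bijectively by the values of vs (no t' exists if the
-- number of occurrences differs from the length of vs).

data LSubV (k : ℕ) : RVal → List RVal → RVal → Set
data LSubT (k : ℕ) : RTm → List RVal → RTm → Set
data LSubB (k : ℕ) : List RVal → List RVal → List RVal → Set

data LSubV k where
  sv-lt  : ∀ {i} → i < k → LSubV k (rvar i) [] (rvar i)
  sv-eq  : ∀ {v} → LSubV k (rvar k) (v ∷ []) (shiftV 0 k v)
  sv-gt  : ∀ {j} → k ≤ j → LSubV k (rvar (suc j)) [] (rvar j)
  sv-lam : ∀ {s vs s'} → LSubT (suc k) s vs s' → LSubV k (rlam s) vs (rlam s')

data LSubT k where
  st-app : ∀ {s₁ s₂ vs vs₁ vs₂ s₁' s₂'} → vs ↭ (vs₁ ++ vs₂) →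
           LSubT k s₁ vs₁ s₁' → LSubT k s₂ vs₂ s₂' →
           LSubT k (rapp s₁ s₂) vs (rapp s₁' s₂')
  st-bag : ∀ {ws vs ws'} → LSubB k ws vs ws' → LSubT k (bag ws) vs (bag ws')

data LSubB k where
  sb-nil  : LSubB k [] [] []
  sb-cons : ∀ {w ws vs vs₁ vs₂ w' ws'} → vs ↭ (vs₁ ++ vs₂) →
            LSubV k w vs₁ w' → LSubB k ws vs₂ ws' →
            LSubB k (w ∷ ws) vs (w' ∷ ws')

-- Resource reduction (Kerinec–Manzonetto–Pagani, Defs 3.3–3.4).
-- s ↦ t : t belongs to the finite set T obtained by contracting one redex
-- in s (s → T).  Redexes whose contractum is ∅ contribute no t.

data _↦_ : RTm → RTm → Set
data _↦B_ : List RVal → List RVal → Set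

data _↦_ where
  β     : ∀ {t vs t'} → LSubT 0 t vs t' →
          rapp (bag (rlam t ∷ [])) (bag vs) ↦ t'
  appL  : ∀ {s s' t} → s ↦ s' → rapp s t ↦ rapp s' t
  appR  : ∀ {s t t'} → t ↦ t' → rapp s t ↦ rapp s t'
  inBag : ∀ {ws ws'} → ws ↦B ws' → bag ws ↦ bag ws'

data _↦B_ where
  here  : ∀ {s s' ws} → s ↦ s' → (rlam s ∷ ws) ↦B (rlam s' ∷ ws)
  there : ∀ {w ws ws'} → ws ↦B ws' → (w ∷ ws) ↦B (w ∷ ws')

-- presence of a redex (including those reducing to ∅)
data HasRedex : RTm → Set
data HasRedexB : List RVal → Set

data HasRedex where
  r-β    : ∀ {t vs} → HasRedex (rapp (bag (rlam t ∷ [])) (bag vs))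
  r-zero : ∀ {ws s} → length ws ≢ 1 → HasRedex (rapp (bag ws) s)
  r-appL : ∀ {s t} → HasRedex s → HasRedex (rapp s t)
  r-appR : ∀ {s t} → HasRedex t → HasRedex (rapp s t)
  r-bag  : ∀ {ws} → HasRedexB ws → HasRedex (bag ws)

data HasRedexB where
  here  : ∀ {s ws} → HasRedex s → HasRedexB (rlam s ∷ ws)
  there : ∀ {w ws} → HasRedexB ws → HasRedexB (w ∷ ws)

Normal : RTm → Set
Normal s = ¬ HasRedex s

-- u ∈nf s : u is an element of nf(s).  Since →r is confluent and strongly
-- normalising, nf(s) = ⋃_{t ∈ T} nf(t) for any step s → T, and nf(s) = {s}
-- for s normal.
data _∈nf_ : RTm → RTm → Set where
  nf-normal : ∀ {s} → Normal s → s ∈nf s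
  nf-step   : ∀ {s t u} → s ↦ t → u ∈nf t → u ∈nf s

-- Taylor expansion (as a membership relation)

data _∈T_ : RTm → Λ → Set
data TBag : List RVal → Λ → Set

data _∈T_ where
  t-var : ∀ m n → bag (replicate m (rvar n)) ∈T var n
  t-lam : ∀ {ws M} → TBag ws M → bag ws ∈T lam M
  t-app : ∀ {s₁ s₂ M₁ M₂} → s₁ ∈T M₁ → s₂ ∈T M₂ → rapp s₁ s₂ ∈T app M₁ M₂

data TBag where
  []  : ∀ {M} → TBag [] M
  _∷_ : ∀ {s ws M} → s ∈T M → TBag ws M → TBag (rlam s ∷ ws) M

NFT : Λ → RTm → Set
NFT M u = Σ RTm λ s → s ∈T M × Σ RTm λ u' → u' ∈nf s × u ≈T u'

_=T_ : Λ → Λ → Set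
M =T N = ∀ u → (NFT M u → NFT N u) × (NFT N u → NFT M u)

-- An element of T(Por (M , Ω)) is  s [λz.z s₁ s₂, …]  with every sᵢ₂ ∈ T(Ω).  If the bag is
-- nonempty, it contains an approximant [λx.x^a x^b][λx.x^c x^d, …] of Ω; such a term is stuck
-- forever (it reduces only to approximants of Ω, which are never normal), and substitution
-- and reduction never erase it, so the whole term has no normal form.  Hence the approximant
-- of Por (True , Ω) yielding the normal form [] of True has an empty bag; but then it is also
-- an approximant of Por (Ω , Ω), whose expansion must have no normal form at all.
module Submission where

open import Defs
open import Data.Product using (Σ; _×_; _,_; proj₁; proj₂)
open import Data.Sum using (_⊎_; inj₁; inj₂)
open import Relation.Nullary using (¬_)
open import Data.Nat using (ℕ; zero; suc)
open import Data.Empty using (⊥-elim)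
open import Function using (id)
open import Data.List using ([]; _∷_; replicate)
open import Data.List.Relation.Unary.All using (All; []; _∷_)
open import Data.List.Relation.Unary.Any using (Any; here; there)
import Data.List.Relation.Unary.All.Properties as All
import Data.List.Relation.Unary.Any.Properties as Any
open import Data.List.Relation.Binary.Permutation.Propositional using (↭-refl)
open import Data.List.Relation.Binary.Permutation.Propositional.Properties
  using (↭-empty-inv; All-resp-↭; Any-resp-↭)
open import Relation.Binary.PropositionalEquality using (_≡_; refl; cong)

selfApp : ℕ → ℕ → RTm
selfApp a b = rapp (bag (replicate a (rvar 0))) (bag (replicate b (rvar 0)))

data δApprox : RVal → Set where
  δ-approx : ∀ a b → δApprox (rlam (selfApp a b))

data ΩApprox : RTm → Set where
  Ω-approx : ∀ {ws vs} → All δApprox ws → All δApprox vs → ΩApprox (rapp (bag ws) (bag vs))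

data ContainsΩ : RTm → Set
data ContainsΩᵛ : RVal → Set

data ContainsΩ where
  here   : ∀ {t} → ΩApprox t → ContainsΩ t
  appˡ   : ∀ {s t} → ContainsΩ s → ContainsΩ (rapp s t)
  appʳ   : ∀ {s t} → ContainsΩ t → ContainsΩ (rapp s t)
  in-bag : ∀ {ws} → Any ContainsΩᵛ ws → ContainsΩ (bag ws)

data ContainsΩᵛ where
  under-λ : ∀ {s} → ContainsΩ s → ContainsΩᵛ (rlam s)

shiftB-replicate-var0 : ∀ c d a →
  shiftB (suc c) d (replicate a (rvar 0)) ≡ replicate a (rvar 0)
shiftB-replicate-var0 c d zero    = refl
shiftB-replicate-var0 c d (suc a) = cong (rvar 0 ∷_) (shiftB-replicate-var0 c d a)

shiftV-δApprox : ∀ {c d v} → δApprox v → δApprox (shiftV c d v)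
shiftV-δApprox {c} {d} (δ-approx a b)
  rewrite shiftB-replicate-var0 c d a | shiftB-replicate-var0 c d b = δ-approx a b

shiftB-δApprox : ∀ {c d ws} → All δApprox ws → All δApprox (shiftB c d ws)
shiftB-δApprox []       = []
shiftB-δApprox (p ∷ ps) = shiftV-δApprox p ∷ shiftB-δApprox ps

shiftT-ContainsΩ : ∀ {c d t} → ContainsΩ t → ContainsΩ (shiftT c d t)
shiftV-ContainsΩ : ∀ {c d v} → ContainsΩᵛ v → ContainsΩᵛ (shiftV c d v)
shiftB-ContainsΩ : ∀ {c d ws} → Any ContainsΩᵛ ws → Any ContainsΩᵛ (shiftB c d ws)
shiftT-ContainsΩ (here (Ω-approx ws vs)) = here (Ω-approx (shiftB-δApprox ws) (shiftB-δApprox vs))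
shiftT-ContainsΩ (appˡ p)   = appˡ (shiftT-ContainsΩ p)
shiftT-ContainsΩ (appʳ p)   = appʳ (shiftT-ContainsΩ p)
shiftT-ContainsΩ (in-bag p) = in-bag (shiftB-ContainsΩ p)
shiftV-ContainsΩ (under-λ p) = under-λ (shiftT-ContainsΩ p)
shiftB-ContainsΩ (here p)  = here (shiftV-ContainsΩ p)
shiftB-ContainsΩ (there p) = there (shiftB-ContainsΩ p)

-- Approximants of Ω are closed, so a linear substitution into them consumes nothing.

LSubB-replicate-var0 : ∀ a {k vs ws'} → LSubB (suc k) (replicate a (rvar 0)) vs ws' →
                       vs ≡ [] × ws' ≡ replicate a (rvar 0)
LSubB-replicate-var0 zero sb-nil = refl , refl
LSubB-replicate-var0 (suc a) (sb-cons p (sv-lt _) σ) with LSubB-replicate-var0 a σ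
... | refl , refl = ↭-empty-inv p , refl

LSubV-δApprox : ∀ {k v vs v'} → δApprox v → LSubV k v vs v' → vs ≡ [] × v' ≡ v
LSubV-δApprox (δ-approx a b) (sv-lam (st-app p (st-bag σ₁) (st-bag σ₂)))
  with LSubB-replicate-var0 a σ₁ | LSubB-replicate-var0 b σ₂
... | refl , refl | refl , refl = ↭-empty-inv p , refl

LSubB-δApprox : ∀ {k ws vs ws'} → All δApprox ws → LSubB k ws vs ws' → vs ≡ [] × ws' ≡ ws
LSubB-δApprox []       sb-nil = refl , refl
LSubB-δApprox (d ∷ ds) (sb-cons p σ₁ σ₂) with LSubV-δApprox d σ₁ | LSubB-δApprox ds σ₂
... | refl , refl | refl , refl = ↭-empty-inv p , refl

LSubT-ΩApprox : ∀ {k t vs t'} → ΩApprox t → LSubT k t vs t' → vs ≡ [] × t' ≡ t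
LSubT-ΩApprox (Ω-approx ws vs) (st-app p (st-bag σ₁) (st-bag σ₂))
  with LSubB-δApprox ws σ₁ | LSubB-δApprox vs σ₂
... | refl , refl | refl , refl = ↭-empty-inv p , refl

LSubT-ContainsΩ : ∀ {k t vs t'} → LSubT k t vs t' →
                  ContainsΩ t ⊎ Any ContainsΩᵛ vs → ContainsΩ t'
LSubB-ContainsΩ : ∀ {k ws vs ws'} → LSubB k ws vs ws' →
                  Any ContainsΩᵛ ws ⊎ Any ContainsΩᵛ vs → Any ContainsΩᵛ ws'
LSubV-ContainsΩ : ∀ {k v vs v'} → LSubV k v vs v' →
                  ContainsΩᵛ v ⊎ Any ContainsΩᵛ vs → ContainsΩᵛ v'
LSubT-ContainsΩ σ@(st-app _ _ _) (inj₁ (here ω)) with LSubT-ΩApprox ω σ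
... | refl , refl = here ω
LSubT-ContainsΩ (st-app _ σ₁ _) (inj₁ (appˡ p)) = appˡ (LSubT-ContainsΩ σ₁ (inj₁ p))
LSubT-ContainsΩ (st-app _ _ σ₂) (inj₁ (appʳ p)) = appʳ (LSubT-ContainsΩ σ₂ (inj₁ p))
LSubT-ContainsΩ (st-app {vs₁ = vs₁} q σ₁ σ₂) (inj₂ p) with Any.++⁻ vs₁ (Any-resp-↭ q p)
... | inj₁ p₁ = appˡ (LSubT-ContainsΩ σ₁ (inj₂ p₁))
... | inj₂ p₂ = appʳ (LSubT-ContainsΩ σ₂ (inj₂ p₂))
LSubT-ContainsΩ (st-bag σ) (inj₁ (in-bag p)) = in-bag (LSubB-ContainsΩ σ (inj₁ p))
LSubT-ContainsΩ (st-bag σ) (inj₂ p)          = in-bag (LSubB-ContainsΩ σ (inj₂ p))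
LSubB-ContainsΩ sb-nil (inj₁ ())
LSubB-ContainsΩ sb-nil (inj₂ ())
LSubB-ContainsΩ (sb-cons _ σ₁ _) (inj₁ (here p))  = here (LSubV-ContainsΩ σ₁ (inj₁ p))
LSubB-ContainsΩ (sb-cons _ _ σ₂) (inj₁ (there p)) = there (LSubB-ContainsΩ σ₂ (inj₁ p))
LSubB-ContainsΩ (sb-cons {vs₁ = vs₁} q σ₁ σ₂) (inj₂ p) with Any.++⁻ vs₁ (Any-resp-↭ q p)
... | inj₁ p₁ = here (LSubV-ContainsΩ σ₁ (inj₂ p₁))
... | inj₂ p₂ = there (LSubB-ContainsΩ σ₂ (inj₂ p₂))
LSubV-ContainsΩ (sv-lt _) (inj₁ ())
LSubV-ContainsΩ (sv-lt _) (inj₂ ())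
LSubV-ContainsΩ sv-eq (inj₁ ())
LSubV-ContainsΩ sv-eq (inj₂ (here p)) = shiftV-ContainsΩ p
LSubV-ContainsΩ sv-eq (inj₂ (there ()))
LSubV-ContainsΩ (sv-gt _) (inj₁ ())
LSubV-ContainsΩ (sv-gt _) (inj₂ ())
LSubV-ContainsΩ (sv-lam σ) (inj₁ (under-λ p)) = under-λ (LSubT-ContainsΩ σ (inj₁ p))
LSubV-ContainsΩ (sv-lam σ) (inj₂ p)           = under-λ (LSubT-ContainsΩ σ (inj₂ p))

LSubB-replicate-var0-δApprox : ∀ a {vs ws'} → LSubB 0 (replicate a (rvar 0)) vs ws' →
                               All δApprox vs → All δApprox ws'
LSubB-replicate-var0-δApprox zero sb-nil _ = []
LSubB-replicate-var0-δApprox (suc a) (sb-cons _ (sv-lt ()) _) _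
LSubB-replicate-var0-δApprox (suc a) (sb-cons {vs₁ = vs₁} p sv-eq σ) ds
  with All.++⁻ vs₁ (All-resp-↭ p ds)
... | d ∷ [] , ds₂ = shiftV-δApprox d ∷ LSubB-replicate-var0-δApprox a σ ds₂

replicate-var-irreducible : ∀ a {n ws} → ¬ (replicate a (rvar n) ↦B ws)
replicate-var-irreducible (suc a) (there r) = replicate-var-irreducible a r

selfApp-irreducible : ∀ a b {t} → ¬ (selfApp a b ↦ t)
selfApp-irreducible zero    b (appL (inBag r)) = replicate-var-irreducible zero {n = 0} r
selfApp-irreducible (suc a) b (appL (inBag r)) = replicate-var-irreducible (suc a) r
selfApp-irreducible zero    b (appR (inBag r)) = replicate-var-irreducible b r
selfApp-irreducible (suc a) b (appR (inBag r)) = replicate-var-irreducible b r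

δApprox-bag-irreducible : ∀ {ws ws'} → All δApprox ws → ¬ (ws ↦B ws')
δApprox-bag-irreducible (δ-approx a b ∷ _) (here r)  = selfApp-irreducible a b r
δApprox-bag-irreducible (_ ∷ ds)           (there r) = δApprox-bag-irreducible ds r

↦-ΩApprox : ∀ {t t'} → ΩApprox t → t ↦ t' → ΩApprox t'
↦-ΩApprox (Ω-approx (δ-approx a b ∷ []) vs) (β (st-app {vs₁ = vs₁} p (st-bag σ₁) (st-bag σ₂)))
  with All.++⁻ vs₁ (All-resp-↭ p vs)
... | vs₁-δ , vs₂-δ = Ω-approx (LSubB-replicate-var0-δApprox a σ₁ vs₁-δ)
                               (LSubB-replicate-var0-δApprox b σ₂ vs₂-δ)
↦-ΩApprox (Ω-approx ws _) (appL (inBag r)) = ⊥-elim (δApprox-bag-irreducible ws r)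
↦-ΩApprox (Ω-approx _ vs) (appR (inBag r)) = ⊥-elim (δApprox-bag-irreducible vs r)

ΩApprox-redex : ∀ {t} → ΩApprox t → HasRedex t
ΩApprox-redex (Ω-approx []                 _) = r-zero (λ ())
ΩApprox-redex (Ω-approx (δ-approx _ _ ∷ []) _) = r-β
ΩApprox-redex (Ω-approx (_ ∷ _ ∷ _)        _) = r-zero (λ ())

ContainsΩ-redex  : ∀ {t} → ContainsΩ t → HasRedex t
ContainsΩ-redexB : ∀ {ws} → Any ContainsΩᵛ ws → HasRedexB ws
ContainsΩ-redex (here ω)   = ΩApprox-redex ω
ContainsΩ-redex (appˡ p)   = r-appL (ContainsΩ-redex p)
ContainsΩ-redex (appʳ p)   = r-appR (ContainsΩ-redex p)
ContainsΩ-redex (in-bag p) = r-bag (ContainsΩ-redexB p)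
ContainsΩ-redexB (here (under-λ p)) = here (ContainsΩ-redex p)
ContainsΩ-redexB (there p)          = there (ContainsΩ-redexB p)

↦-ContainsΩ  : ∀ {t t'} → ContainsΩ t → t ↦ t' → ContainsΩ t'
↦B-ContainsΩ : ∀ {ws ws'} → Any ContainsΩᵛ ws → ws ↦B ws' → Any ContainsΩᵛ ws'
↦-ContainsΩ (here ω) r = here (↦-ΩApprox ω r)
↦-ContainsΩ (appˡ (here ()))                   (β σ)
↦-ContainsΩ (appˡ (in-bag (here (under-λ p)))) (β σ) = LSubT-ContainsΩ σ (inj₁ p)
↦-ContainsΩ (appˡ (in-bag (there ())))         (β σ)
↦-ContainsΩ (appʳ (here ()))                   (β σ)
↦-ContainsΩ (appʳ (in-bag p))                  (β σ) = LSubT-ContainsΩ σ (inj₂ p)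
↦-ContainsΩ (appˡ p) (appL r) = appˡ (↦-ContainsΩ p r)
↦-ContainsΩ (appˡ p) (appR _) = appˡ p
↦-ContainsΩ (appʳ p) (appL _) = appʳ p
↦-ContainsΩ (appʳ p) (appR r) = appʳ (↦-ContainsΩ p r)
↦-ContainsΩ (in-bag p) (inBag r) = in-bag (↦B-ContainsΩ p r)
↦B-ContainsΩ (here (under-λ p)) (here r)  = here (under-λ (↦-ContainsΩ p r))
↦B-ContainsΩ (here p)           (there _) = here p
↦B-ContainsΩ (there p)          (here _)  = there p
↦B-ContainsΩ (there p)          (there r) = there (↦B-ContainsΩ p r)

ContainsΩ-∉nf : ∀ {s u} → ContainsΩ s → ¬ (u ∈nf s)
ContainsΩ-∉nf p (nf-normal s-normal) = s-normal (ContainsΩ-redex p)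
ContainsΩ-∉nf p (nf-step r u∈nf)     = ContainsΩ-∉nf (↦-ContainsΩ p r) u∈nf

TBag-δ-body : ∀ {ws} → TBag ws (app (var 0) (var 0)) → All δApprox ws
TBag-δ-body [] = []
TBag-δ-body (t-app (t-var a _) (t-var b _) ∷ ws) = δ-approx a b ∷ TBag-δ-body ws

∈T-Ω⇒ΩApprox : ∀ {s} → s ∈T Ω → ΩApprox s
∈T-Ω⇒ΩApprox (t-app (t-lam ws) (t-lam vs)) = Ω-approx (TBag-δ-body ws) (TBag-δ-body vs)

NFT-Ω-empty : ∀ {u} → ¬ NFT Ω u
NFT-Ω-empty (_ , s∈TΩ , _ , u∈nf , _) = ContainsΩ-∉nf (here (∈T-Ω⇒ΩApprox s∈TΩ)) u∈nf

NFT-True-[] : NFT True (bag [])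
NFT-True-[] = bag [] , t-lam [] , bag [] , nf-normal (λ { (r-bag ()) }) , ≈bag ↭-refl []

True≠TΩ : ¬ (True =T Ω)
True≠TΩ True=TΩ = NFT-Ω-empty (proj₁ (True=TΩ (bag [])) NFT-True-[])

=T-refl : ∀ {M} → M =T M
=T-refl _ = id , id

∈T-app-pair-Ω : ∀ {P M M' N' s} → s ∈T app P (pair M Ω) →
                s ∈T app P (pair M' N') ⊎ ContainsΩ s
∈T-app-pair-Ω (t-app s∈TP (t-lam []))        = inj₁ (t-app s∈TP (t-lam []))
∈T-app-pair-Ω (t-app _ (t-lam (t-app _ s∈TΩ ∷ _))) =
  inj₂ (appʳ (in-bag (here (under-λ (appʳ (here (∈T-Ω⇒ΩApprox s∈TΩ)))))))

mainTheorem2 : ¬ (Σ Λ λ Por → ∀ M N →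
                    ((¬ (M =T Ω) ⊎ ¬ (N =T Ω)) → app Por (pair M N) =T True)
                  × (M =T Ω → N =T Ω → app Por (pair M N) =T Ω))
mainTheorem2 (Por , spec)
  with proj₂ (proj₁ (spec True Ω) (inj₁ True≠TΩ) (bag [])) NFT-True-[]
... | s , s∈T , u , u∈nf , []≈u with ∈T-app-pair-Ω {M = True} {M' = Ω} {N' = Ω} s∈T
... | inj₁ s∈T' = NFT-Ω-empty (proj₁ (proj₂ (spec Ω Ω) =T-refl =T-refl (bag []))
                                     (s , s∈T' , u , u∈nf , []≈u))
... | inj₂ s-containsΩ = ContainsΩ-∉nf s-containsΩ u∈nf
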